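{- Let $p$ be a prime and $n\ge 1$. Let $\max\colon \mathbb{F}_p{}^n\to\mathbb{F}_p$ send $x=(x_0,\dots,x_{n-1})$ to the largest of $x_0,\dots,x_{n-1}$. Then the minimal polynomial of $\max$ is \[ \max(x)=\sum_{1\le t\le p-1}\Bigl(1-\prod_{i=0}^{n-1}L_t(x_i)\Bigr), \] where $L_t(x)=\sum_{0\le k<t}\bigl(1-(x-k)^{p-1}\bigr)$. Moreover, as functions, $\max(x)=\sum_{1\le t\le p-1}\chi(x_i\ge t\text{ for some } i)$.
   Context: $\mathbb{F}_p$ is identified with $\{0,1,\dots,p-1\}\subset\mathbb{Z}$, and comparisons ($<$, $\le$, max) are taken in this ordering of integers, while addition and multiplication are in $\mathbb{F}_p$. For a function $f\colon\mathbb{F}_p{}^n\to\mathbb{F}_p$, its minimal polynomial is the unique polynomial over $\mathbb{F}_p$ of degree at most $p-1$ in each variable that coincides with $f$ as a function. For a statement $P$, $\chi(P)$ is $1$ if $P$ is true and $0$ otherwise. For an integer $0\le t\le p$, $L_t(x)=\sum_{0\le k<t}(1-(x-k)^{p-1})$ is the minimal polynomial of the function $x\mapsto\chi(x<t)$. -}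

module Defs where

open import Data.Nat using (ℕ; zero; suc; _+_; _*_; _∸_; _≤_; _≤ᵇ_; _≤?_; NonZero)
open import Data.Nat.DivMod using (_%_; m%n<n)
open import Data.Fin using (Fin; toℕ; fromℕ<)
open import Data.Fin.Properties using (any?)
open import Data.Vec.Functional using (_∷_)
open import Data.Bool using (Bool; true; false; if_then_else_)
open import Data.Product using (∃; _×_)
open import Relation.Nullary.Decidable using (⌊_⌋)
open import Relation.Binary.PropositionalEquality using (_≡_)
open import Function using (_∘_)

module Fp (p : ℕ) .{{_ : NonZero p}} where

  F : Set
  F = Fin p

  ⟦_⟧ : ℕ → F
  ⟦ m ⟧ = fromℕ< (m%n<n m p)

  0F 1F : F
  0F = ⟦ 0 ⟧
  1F = ⟦ 1 ⟧

  _+F_ _*F_ _-F_ : F → F → F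
  a +F b = ⟦ toℕ a + toℕ b ⟧
  a *F b = ⟦ toℕ a * toℕ b ⟧
  a -F b = ⟦ toℕ a + (p ∸ toℕ b) ⟧

  _^F_ : F → ℕ → F
  a ^F zero = 1F
  a ^F suc k = a *F (a ^F k)

  ΣF : ℕ → (ℕ → F) → F
  ΣF zero f = 0F
  ΣF (suc m) f = ΣF m f +F f m

  χ : Bool → F
  χ true = 1F
  χ false = 0F

  -- maximum w.r.t. the integer ordering of {0,…,p-1}; (max of the empty tuple is 0)
  maxF : (n : ℕ) → (Fin n → F) → F
  maxF zero x = 0F
  maxF (suc n) x = let a = x Fin.zero ; b = maxF n (x ∘ Fin.suc) in
                   if toℕ a ≤ᵇ toℕ b then b else a

  -- Polynomials in n variables over 𝔽_p, given by their coefficient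
  -- function on exponent vectors (Fin n → ℕ).

  Monomial : ℕ → Set
  Monomial n = Fin n → ℕ

  Poly : ℕ → Set
  Poly n = Monomial n → F

  ΣBox : (n : ℕ) → Monomial n → (Monomial n → F) → F
  ΣBox zero b f = f (λ ())
  ΣBox (suc n) b f = ΣF (suc (b Fin.zero)) (λ k → ΣBox n (b ∘ Fin.suc) (λ e → f (k ∷ e)))

  isZeroMon : (n : ℕ) → Monomial n → Bool
  isZeroMon zero e = true
  isZeroMon (suc n) e with e Fin.zero
  ... | zero = isZeroMon n (e ∘ Fin.suc)
  ... | suc _ = false

  isVarMon : (n : ℕ) → Fin n → Monomial n → Bool
  isVarMon (suc n) Fin.zero e with e Fin.zero
  ... | 1 = isZeroMon n (e ∘ Fin.suc)
  ... | _ = false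
  isVarMon (suc n) (Fin.suc i) e with e Fin.zero
  ... | zero = isVarMon n i (e ∘ Fin.suc)
  ... | suc _ = false

  constP : (n : ℕ) → F → Poly n
  constP n c e = if isZeroMon n e then c else 0F

  varP : (n : ℕ) → Fin n → Poly n
  varP n i e = if isVarMon n i e then 1F else 0F

  addP subP : (n : ℕ) → Poly n → Poly n → Poly n
  addP n P Q e = P e +F Q e
  subP n P Q e = P e -F Q e

  mulP : (n : ℕ) → Poly n → Poly n → Poly n
  mulP n P Q e = ΣBox n e (λ e₁ → P e₁ *F Q (λ i → e i ∸ e₁ i))

  powP : (n : ℕ) → Poly n → ℕ → Poly n
  powP n P zero = constP n 1F
  powP n P (suc k) = mulP n P (powP n P k)

  sumP : (n : ℕ) → ℕ → (ℕ → Poly n) → Poly n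
  sumP n zero P = constP n 0F
  sumP n (suc m) P = addP n (sumP n m P) (P m)

  prodFinP : (n m : ℕ) → (Fin m → Poly n) → Poly n
  prodFinP n zero P = constP n 1F
  prodFinP n (suc m) P = mulP n (P Fin.zero) (prodFinP n m (P ∘ Fin.suc))

  L : (n : ℕ) → ℕ → Fin n → Poly n
  L n t i = sumP n t (λ k → subP n (constP n 1F)
                                    (powP n (subP n (varP n i) (constP n ⟦ k ⟧)) (p ∸ 1)))

  maxPoly : (n : ℕ) → Poly n
  maxPoly n = sumP n (p ∸ 1) (λ k → subP n (constP n 1F) (prodFinP n n (L n (suc k))))

  Reduced : (n : ℕ) → Poly n → Set
  Reduced n P = (e : Monomial n) → (∃ λ i → p ≤ e i) → P e ≡ 0F

  -- evaluation of a reduced polynomial (its support lies in {0,…,p-1}^n)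
  evalReduced : (n : ℕ) → Poly n → (Fin n → F) → F
  evalReduced n P x =
    ΣBox n (λ _ → p ∸ 1) (λ e → P e *F prodF n (λ i → x i ^F e i))
    where
    prodF : (m : ℕ) → (Fin m → F) → F
    prodF zero g = 1F
    prodF (suc m) g = g Fin.zero *F prodF m (g ∘ Fin.suc)

  IsMinimalPolynomial : (n : ℕ) → ((Fin n → F) → F) → Poly n → Set
  IsMinimalPolynomial n f Q = Reduced n Q × (∀ x → evalReduced n Q x ≡ f x)

  χsome≥ : (n : ℕ) → ℕ → (Fin n → F) → F
  χsome≥ n t x = χ ⌊ any? (λ i → t ≤? toℕ (x i)) ⌋

-- Fermat's little theorem makes 1 − (x − k)^(p−1) the indicator of x = k, so L_t(x) is the
-- indicator of x < t, the product ∏ᵢ L_t(xᵢ) is the indicator of max x < t, and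
-- Σ_{1≤t≤p−1} (1 − ∏ᵢ L_t(xᵢ)) counts the t with 1 ≤ t ≤ max x, which is max x.
-- Fermat itself comes from (x + 1)^p = x^p + 1, as p divides every middle binomial coefficient.
-- The polynomial is reduced by a degree count: L_t(xᵢ) has degree p − 1 and involves xᵢ only.
-- Evaluating a coefficient function means summing over a box of exponents, and this is
-- multiplicative once the supports of the two factors add up inside the box (in each variable
-- it is a Cauchy product); that is what lets the evaluation pass through the products above.

module Submission where

open import Defs
open import Level using (0ℓ)
open import Algebra.Bundles using (Semiring; CommutativeRing)
import Algebra.Properties.CommutativeSemigroup as CommSemigroupProperties
import Algebra.Properties.Ring as RingProperties
open import Data.Bool.Base using (true; false; if_then_else_; T)
open import Data.Empty using (⊥-elim)
open import Data.Fin as Fin using (Fin; toℕ; inject₁)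
import Data.Fin.Properties as Finₚ
open import Data.Nat.Base using (ℕ; zero; suc; _∸_; _≤_; _<_; z≤n; s≤s; s≤s⁻¹; z<s; s<s; NonZero; >-nonZero⁻¹)
open import Data.Nat.Combinatorics using (_C_; nCn≡1)
open import Data.Nat.DivMod using (_%_; m<n⇒m%n≡m; %-distribˡ-+; %-distribˡ-*)
open import Data.Nat.Divisibility using (_∣_; ∣-refl; n∣m⇒m%n≡0; m%n≡0⇒n∣m)
open import Data.Nat.Primality using (Prime; prime⇒nonZero; euclidsLemma)
open import Data.Nat.Properties as ℕₚ using (_≟_; _<?_; _≤?_)
open import Data.Product using (_×_; _,_; ∃)
open import Data.Sum using (_⊎_; inj₁; inj₂)
open import Data.Vec.Functional using (_∷_; tail; init; last)
open import Function using (_∘_)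
open import Relation.Binary.Definitions using (tri<; tri≈; tri>)
open import Relation.Binary.PropositionalEquality
  using (_≡_; refl; sym; trans; cong; cong₂; subst; isEquivalence; module ≡-Reasoning)
open import Relation.Nullary using (Dec; yes; no; ¬_)
open import Relation.Nullary.Decidable using (⌊_⌋)

module FreshmansDream {a ℓ} (S : Semiring a ℓ) where

  open Semiring S hiding (zero) renaming (refl to ≈-refl; sym to ≈-sym; trans to ≈-trans)
  open import Algebra.Properties.Semiring.Exp S using (_^_)
  open import Algebra.Properties.Semiring.Mult S using (×-congʳ; ×-homo-1; ×-assoc-*)
    renaming (_×_ to _·_)
  open import Algebra.Properties.Semiring.Sum S using (sum; sum-init-last; sum-replicate-zero; sum-cong-≋)
  import Algebra.Properties.Semiring.Binomial S as Binomial
  open import Relation.Binary.Reasoning.Setoid setoid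

  1#^n≈1# : ∀ n → 1# ^ n ≈ 1#
  1#^n≈1# zero = ≈-refl
  1#^n≈1# (suc n) = ≈-trans (*-identityˡ _) (1#^n≈1# n)

  m·1#≈0#⇒m·y≈0# : ∀ m → m · 1# ≈ 0# → ∀ y → m · y ≈ 0#
  m·1#≈0#⇒m·y≈0# m m·1≈0 y = begin
    m · y            ≈⟨ ×-congʳ m (*-identityˡ y) ⟨
    m · (1# * y)     ≈⟨ ×-assoc-* m 1# y ⟨
    (m · 1#) * y     ≈⟨ *-congʳ m·1≈0 ⟩
    0# * y           ≈⟨ zeroˡ y ⟩
    0#               ∎

  [x+1]^n≈x^n+1 : ∀ n .{{_ : NonZero n}} → (∀ k → 0 < k → k < n → (n C k) · 1# ≈ 0#) →
                  ∀ x → (x + 1#) ^ n ≈ x ^ n + 1#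
  [x+1]^n≈x^n+1 (suc n) C≈0 x = begin
    (x + 1#) ^ suc n                                       ≈⟨ Binomial.theorem x 1# x*1≈1*x (suc n) ⟩
    t Fin.zero + sum (tail t)                              ≈⟨ +-congˡ (sum-init-last (tail t)) ⟩
    t Fin.zero + (sum (init (tail t)) + last (tail t))     ≈⟨ +-cong first (+-cong middle final) ⟩
    1# + (0# + x ^ suc n)                                  ≈⟨ +-congˡ (+-identityˡ _) ⟩
    1# + x ^ suc n                                         ≈⟨ +-comm _ _ ⟩
    x ^ suc n + 1#                                         ∎
    where
    t = Binomial.binomialTerm x 1# (suc n)
    x*1≈1*x : x * 1# ≈ 1# * x
    x*1≈1*x = ≈-trans (*-identityʳ x) (≈-sym (*-identityˡ x))
    first : t Fin.zero ≈ 1#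
    first = ≈-trans (×-homo-1 _) (≈-trans (*-identityˡ _) (1#^n≈1# (suc n)))
    middle : sum (init (tail t)) ≈ 0#
    middle = ≈-trans (sum-cong-≋ λ i → m·1#≈0#⇒m·y≈0# (suc n C suc (toℕ (inject₁ i)))
                                         (C≈0 _ z<s (s<s (Finₚ.inject₁ℕ< i))) _)
                     (sum-replicate-zero n)
    final : last (tail t) ≈ x ^ suc n
    final = begin
      last (tail t)
        ≡⟨ cong (λ k → (suc n C k) · (x ^ k * 1# ^ (suc n ∸ k))) (Finₚ.toℕ-fromℕ (suc n)) ⟩
      (suc n C suc n) · (x ^ suc n * 1# ^ (n ∸ n))
        ≡⟨ cong₂ (λ c e → c · (x ^ suc n * 1# ^ e)) (nCn≡1 (suc n)) (ℕₚ.n∸n≡0 n) ⟩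
      1 · (x ^ suc n * 1#)                              ≈⟨ ×-homo-1 _ ⟩
      x ^ suc n * 1#                                    ≈⟨ *-identityʳ _ ⟩
      x ^ suc n                                         ∎

module ResidueRing (p : ℕ) .{{_ : NonZero p}} where

  open import Data.Nat.Base using (_+_; _*_)
  open Fp p

  toℕ-⟦⟧ : ∀ m → toℕ ⟦ m ⟧ ≡ m % p
  toℕ-⟦⟧ m = Finₚ.toℕ-fromℕ< _

  ⟦⟧-≡ : ∀ {m m′} → m % p ≡ m′ % p → ⟦ m ⟧ ≡ ⟦ m′ ⟧
  ⟦⟧-≡ eq = Finₚ.toℕ-injective (trans (toℕ-⟦⟧ _) (trans eq (sym (toℕ-⟦⟧ _))))

  ⟦toℕ⟧ : ∀ a → ⟦ toℕ a ⟧ ≡ a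
  ⟦toℕ⟧ a = Finₚ.toℕ-injective (trans (toℕ-⟦⟧ _) (m<n⇒m%n≡m (Finₚ.toℕ<n a)))

  toℕ-0F : toℕ 0F ≡ 0
  toℕ-0F = trans (toℕ-⟦⟧ 0) (m<n⇒m%n≡m (>-nonZero⁻¹ p))

  p∣⇒⟦⟧≡0F : ∀ {m} → p ∣ m → ⟦ m ⟧ ≡ 0F
  p∣⇒⟦⟧≡0F {m} p∣m = ⟦⟧-≡ (trans (n∣m⇒m%n≡0 m p p∣m) (sym (m<n⇒m%n≡m (>-nonZero⁻¹ p))))

  ⟦⟧≡0F⇒p∣ : ∀ {m} → ⟦ m ⟧ ≡ 0F → p ∣ m
  ⟦⟧≡0F⇒p∣ {m} eq = m%n≡0⇒n∣m m p (trans (sym (toℕ-⟦⟧ m)) (trans (cong toℕ eq) toℕ-0F))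

  ⟦⟧-+ : ∀ m m′ → ⟦ m ⟧ +F ⟦ m′ ⟧ ≡ ⟦ m + m′ ⟧
  ⟦⟧-+ m m′ = ⟦⟧-≡ (trans (cong₂ (λ a b → (a + b) % p) (toℕ-⟦⟧ m) (toℕ-⟦⟧ m′))
                           (sym (%-distribˡ-+ m m′ p)))

  ⟦⟧-* : ∀ m m′ → ⟦ m ⟧ *F ⟦ m′ ⟧ ≡ ⟦ m * m′ ⟧
  ⟦⟧-* m m′ = ⟦⟧-≡ (trans (cong₂ (λ a b → (a * b) % p) (toℕ-⟦⟧ m) (toℕ-⟦⟧ m′))
                           (sym (%-distribˡ-* m m′ p)))

  negF : F → F
  negF a = ⟦ p ∸ toℕ a ⟧

  -F≡+negF : ∀ a b → a -F b ≡ a +F negF b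
  -F≡+negF a b = trans (sym (⟦⟧-+ (toℕ a) _)) (cong (_+F negF b) (⟦toℕ⟧ a))

  commutativeRing : CommutativeRing 0ℓ 0ℓ
  commutativeRing = record
    { isCommutativeRing = record
      { isRing = record
        { +-isAbelianGroup = record
          { isGroup = record
            { isMonoid = record
              { isSemigroup = record
                { isMagma = record { isEquivalence = isEquivalence ; ∙-cong = cong₂ _+F_ }
                ; assoc = +-assoc }
              ; identity = +-identityˡ , λ a → trans (+-comm a 0F) (+-identityˡ a) }
            ; inverse = -‿inverseˡ , λ a → trans (+-comm a (negF a)) (-‿inverseˡ a)
            ; ⁻¹-cong = cong negF }
          ; comm = +-comm }
        ; *-cong = cong₂ _*F_
        ; *-assoc = *-assoc
        ; *-identity = *-identityˡ , λ a → trans (*-comm a 1F) (*-identityˡ a)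
        ; distrib = distribˡ , λ a b c → trans (*-comm (b +F c) a)
                                          (trans (distribˡ a b c) (cong₂ _+F_ (*-comm a b) (*-comm a c))) }
      ; *-comm = *-comm } }
    where
    open ≡-Reasoning

    +-comm : ∀ a b → a +F b ≡ b +F a
    +-comm a b = cong ⟦_⟧ (ℕₚ.+-comm (toℕ a) (toℕ b))

    *-comm : ∀ a b → a *F b ≡ b *F a
    *-comm a b = cong ⟦_⟧ (ℕₚ.*-comm (toℕ a) (toℕ b))

    +-assoc : ∀ a b c → (a +F b) +F c ≡ a +F (b +F c)
    +-assoc a b c = begin
      ⟦ toℕ a + toℕ b ⟧ +F c                ≡⟨ cong (⟦ toℕ a + toℕ b ⟧ +F_) (sym (⟦toℕ⟧ c)) ⟩
      ⟦ toℕ a + toℕ b ⟧ +F ⟦ toℕ c ⟧        ≡⟨ ⟦⟧-+ _ _ ⟩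
      ⟦ toℕ a + toℕ b + toℕ c ⟧             ≡⟨ cong ⟦_⟧ (ℕₚ.+-assoc (toℕ a) _ _) ⟩
      ⟦ toℕ a + (toℕ b + toℕ c) ⟧           ≡⟨ sym (⟦⟧-+ _ _) ⟩
      ⟦ toℕ a ⟧ +F ⟦ toℕ b + toℕ c ⟧        ≡⟨ cong (_+F (b +F c)) (⟦toℕ⟧ a) ⟩
      a +F (b +F c)                         ∎

    *-assoc : ∀ a b c → (a *F b) *F c ≡ a *F (b *F c)
    *-assoc a b c = begin
      ⟦ toℕ a * toℕ b ⟧ *F c                ≡⟨ cong (⟦ toℕ a * toℕ b ⟧ *F_) (sym (⟦toℕ⟧ c)) ⟩
      ⟦ toℕ a * toℕ b ⟧ *F ⟦ toℕ c ⟧        ≡⟨ ⟦⟧-* _ _ ⟩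
      ⟦ toℕ a * toℕ b * toℕ c ⟧             ≡⟨ cong ⟦_⟧ (ℕₚ.*-assoc (toℕ a) _ _) ⟩
      ⟦ toℕ a * (toℕ b * toℕ c) ⟧           ≡⟨ sym (⟦⟧-* _ _) ⟩
      ⟦ toℕ a ⟧ *F ⟦ toℕ b * toℕ c ⟧        ≡⟨ cong (_*F (b *F c)) (⟦toℕ⟧ a) ⟩
      a *F (b *F c)                         ∎

    distribˡ : ∀ a b c → a *F (b +F c) ≡ (a *F b) +F (a *F c)
    distribˡ a b c = begin
      a *F ⟦ toℕ b + toℕ c ⟧                ≡⟨ cong (_*F (b +F c)) (sym (⟦toℕ⟧ a)) ⟩
      ⟦ toℕ a ⟧ *F ⟦ toℕ b + toℕ c ⟧        ≡⟨ ⟦⟧-* _ _ ⟩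
      ⟦ toℕ a * (toℕ b + toℕ c) ⟧           ≡⟨ cong ⟦_⟧ (ℕₚ.*-distribˡ-+ (toℕ a) _ _) ⟩
      ⟦ toℕ a * toℕ b + toℕ a * toℕ c ⟧     ≡⟨ sym (⟦⟧-+ _ _) ⟩
      (a *F b) +F (a *F c)                  ∎

    +-identityˡ : ∀ a → 0F +F a ≡ a
    +-identityˡ a = trans (cong (0F +F_) (sym (⟦toℕ⟧ a))) (trans (⟦⟧-+ 0 (toℕ a)) (⟦toℕ⟧ a))

    *-identityˡ : ∀ a → 1F *F a ≡ a
    *-identityˡ a = begin
      1F *F a                   ≡⟨ cong (1F *F_) (sym (⟦toℕ⟧ a)) ⟩
      ⟦ 1 ⟧ *F ⟦ toℕ a ⟧        ≡⟨ ⟦⟧-* 1 (toℕ a) ⟩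
      ⟦ 1 * toℕ a ⟧             ≡⟨ cong ⟦_⟧ (ℕₚ.*-identityˡ (toℕ a)) ⟩
      ⟦ toℕ a ⟧                 ≡⟨ ⟦toℕ⟧ a ⟩
      a                         ∎

    -‿inverseˡ : ∀ a → negF a +F a ≡ 0F
    -‿inverseˡ a = begin
      negF a +F a                       ≡⟨ cong (negF a +F_) (sym (⟦toℕ⟧ a)) ⟩
      ⟦ p ∸ toℕ a ⟧ +F ⟦ toℕ a ⟧        ≡⟨ ⟦⟧-+ _ _ ⟩
      ⟦ p ∸ toℕ a + toℕ a ⟧             ≡⟨ cong ⟦_⟧ (ℕₚ.m∸n+n≡m (ℕₚ.<⇒≤ (Finₚ.toℕ<n a))) ⟩
      ⟦ p ⟧                             ≡⟨ p∣⇒⟦⟧≡0F ∣-refl ⟩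
      0F                                ∎

  open CommutativeRing commutativeRing public
    using ( semiring; +-assoc; +-identityˡ; +-identityʳ; *-assoc; *-comm; *-identityˡ; *-identityʳ
          ; distribˡ; distribʳ; zeroˡ; zeroʳ; -‿inverseʳ )
  open RingProperties (CommutativeRing.ring commutativeRing) public
    using (-‿involutive; -‿+-comm; -0#≈0#; -1*x≈-x; x∙y⁻¹≈ε⇒x≈y; x[y-z]≈xy-xz; [y-z]x≈yx-zx)
  open CommSemigroupProperties (CommutativeRing.+-commutativeSemigroup commutativeRing) public
    using () renaming (interchange to +-interchange)
  open CommSemigroupProperties (CommutativeRing.*-commutativeSemigroup commutativeRing) public
    using () renaming (interchange to *-interchange; x∙yz≈y∙xz to x*[y*z]≡y*[x*z])

  ^F-+ : ∀ a m k → a ^F (m + k) ≡ (a ^F m) *F (a ^F k)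
  ^F-+ a zero k = sym (*-identityˡ _)
  ^F-+ a (suc m) k = trans (cong (a *F_) (^F-+ a m k)) (sym (*-assoc a (a ^F m) (a ^F k)))

module PrimeDivisibility where

  open import Data.Nat.Base using (_*_; _!; nonTrivial⇒n>1)
  open import Data.Nat.Primality using (prime⇒nonTrivial)
  open import Data.Nat.DivMod using (_/_; m*[n/m]≡n)
  open import Data.Nat.Divisibility using (m∣m*n; ∣1⇒≡1; >⇒∤)
  open import Data.Nat.Combinatorics using (nCk≡n!/k![n-k]!; k![n∸k]!∣n!)
  open ≡-Reasoning

  prime⇒1<p : ∀ {p} → Prime p → 1 < p
  prime⇒1<p {p} p-prime = nonTrivial⇒n>1 p {{prime⇒nonTrivial p-prime}}

  n∣n! : ∀ n .{{_ : NonZero n}} → n ∣ n !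
  n∣n! (suc n) = m∣m*n (n !)

  prime∤m! : ∀ {p m} → Prime p → m < p → ¬ p ∣ m !
  prime∤m! {m = zero} p-prime _ p∣1 = ℕₚ.<-irrefl (sym (∣1⇒≡1 p∣1)) (prime⇒1<p p-prime)
  prime∤m! {m = suc m} p-prime m<p p∣m! with euclidsLemma (suc m) (m !) p-prime p∣m!
  ... | inj₁ p∣1+m = >⇒∤ m<p p∣1+m
  ... | inj₂ p∣m! = prime∤m! p-prime (ℕₚ.<-trans (ℕₚ.n<1+n m) m<p) p∣m!

  nCk*[k!*[n∸k]!]≡n! : ∀ {n k} → k ≤ n → (n C k) * (k ! * (n ∸ k) !) ≡ n !
  nCk*[k!*[n∸k]!]≡n! {n} {k} k≤n = begin
    (n C k) * d                  ≡⟨ cong (_* d) (nCk≡n!/k![n-k]! k≤n) ⟩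
    (n ! / d) * d                ≡⟨ ℕₚ.*-comm _ d ⟩
    d * (n ! / d)                ≡⟨ m*[n/m]≡n (k![n∸k]!∣n! k≤n) ⟩
    n !                          ∎
    where
    d = k ! * (n ∸ k) !
    instance _ = k ℕₚ.!* (n ∸ k) !≢0

  prime∣pCk : ∀ {p k} → Prime p → 0 < k → k < p → p ∣ p C k
  prime∣pCk {p} {k} p-prime 0<k k<p
    with euclidsLemma (p C k) (k ! * (p ∸ k) !) p-prime
           (subst (p ∣_) (sym (nCk*[k!*[n∸k]!]≡n! (ℕₚ.<⇒≤ k<p))) (n∣n! p {{prime⇒nonZero p-prime}}))
  ... | inj₁ p∣pCk = p∣pCk
  ... | inj₂ p∣k!*[p∸k]! with euclidsLemma (k !) ((p ∸ k) !) p-prime p∣k!*[p∸k]!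
  ...   | inj₁ p∣k! = ⊥-elim (prime∤m! p-prime k<p p∣k!)
  ...   | inj₂ p∣[p∸k]! = ⊥-elim (prime∤m! p-prime (ℕₚ.∸-monoʳ-< 0<k (ℕₚ.<⇒≤ k<p)) p∣[p∸k]!)

module Fermat (p : ℕ) (p-prime : Prime p) where

  open PrimeDivisibility using (prime⇒1<p; prime∣pCk)

  private instance
    p≢0 : NonZero p
    p≢0 = prime⇒nonZero p-prime

  open Fp p
  open ResidueRing p
  open import Algebra.Properties.Semiring.Exp semiring using (_^_)
  open import Algebra.Properties.Semiring.Mult semiring using () renaming (_×_ to _·_)
  open FreshmansDream semiring using ([x+1]^n≈x^n+1)
  open ≡-Reasoning

  1+[p∸1]≡p : suc (p ∸ 1) ≡ p
  1+[p∸1]≡p = ℕₚ.m+[n∸m]≡n (ℕₚ.<⇒≤ (prime⇒1<p p-prime))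

  ^F≡^ : ∀ x n → x ^F n ≡ x ^ n
  ^F≡^ x zero = refl
  ^F≡^ x (suc n) = cong (x *F_) (^F≡^ x n)

  m·1F≡⟦m⟧ : ∀ m → m · 1F ≡ ⟦ m ⟧
  m·1F≡⟦m⟧ zero = refl
  m·1F≡⟦m⟧ (suc m) = trans (cong (1F +F_) (m·1F≡⟦m⟧ m)) (⟦⟧-+ 1 m)

  [x+1]^p≡x^p+1 : ∀ x → (x +F 1F) ^F p ≡ (x ^F p) +F 1F
  [x+1]^p≡x^p+1 x = begin
    (x +F 1F) ^F p    ≡⟨ ^F≡^ (x +F 1F) p ⟩
    (x +F 1F) ^ p     ≡⟨ [x+1]^n≈x^n+1 p pCk·1≡0 x ⟩
    (x ^ p) +F 1F     ≡⟨ cong (_+F 1F) (^F≡^ x p) ⟨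
    (x ^F p) +F 1F    ∎
    where
    pCk·1≡0 : ∀ k → 0 < k → k < p → (p C k) · 1F ≡ 0F
    pCk·1≡0 k 0<k k<p = trans (m·1F≡⟦m⟧ (p C k)) (p∣⇒⟦⟧≡0F (prime∣pCk p-prime 0<k k<p))

  x^p≡x : ∀ x → x ^F p ≡ x
  x^p≡x x = trans (cong (_^F p) (sym (⟦toℕ⟧ x))) (trans (⟦m⟧^p≡⟦m⟧ (toℕ x)) (⟦toℕ⟧ x))
    where
    ⟦m⟧^p≡⟦m⟧ : ∀ m → ⟦ m ⟧ ^F p ≡ ⟦ m ⟧
    ⟦m⟧^p≡⟦m⟧ zero = subst (λ n → 0F ^F n ≡ 0F) 1+[p∸1]≡p (zeroˡ _)
    ⟦m⟧^p≡⟦m⟧ (suc m) = begin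
      ⟦ suc m ⟧ ^F p        ≡⟨ cong (_^F p) ⟦1+m⟧≡⟦m⟧+1 ⟩
      (⟦ m ⟧ +F 1F) ^F p    ≡⟨ [x+1]^p≡x^p+1 ⟦ m ⟧ ⟩
      (⟦ m ⟧ ^F p) +F 1F    ≡⟨ cong (_+F 1F) (⟦m⟧^p≡⟦m⟧ m) ⟩
      ⟦ m ⟧ +F 1F           ≡⟨ ⟦1+m⟧≡⟦m⟧+1 ⟨
      ⟦ suc m ⟧             ∎
      where
      ⟦1+m⟧≡⟦m⟧+1 : ⟦ suc m ⟧ ≡ ⟦ m ⟧ +F 1F
      ⟦1+m⟧≡⟦m⟧+1 = trans (cong ⟦_⟧ (ℕₚ.+-comm 1 m)) (sym (⟦⟧-+ m 1))

  *-zeroDivisor : ∀ a b → a *F b ≡ 0F → a ≡ 0F ⊎ b ≡ 0F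
  *-zeroDivisor a b ab≡0 with euclidsLemma (toℕ a) (toℕ b) p-prime (⟦⟧≡0F⇒p∣ ab≡0)
  ... | inj₁ p∣a = inj₁ (trans (sym (⟦toℕ⟧ a)) (p∣⇒⟦⟧≡0F p∣a))
  ... | inj₂ p∣b = inj₂ (trans (sym (⟦toℕ⟧ b)) (p∣⇒⟦⟧≡0F p∣b))

  x^[p∸1]≡1 : ∀ x → ¬ x ≡ 0F → x ^F (p ∸ 1) ≡ 1F
  x^[p∸1]≡1 x x≢0 with *-zeroDivisor x (y +F negF 1F) x[y-1]≡0
    where
    y = x ^F (p ∸ 1)
    x[y-1]≡0 : x *F (y +F negF 1F) ≡ 0F
    x[y-1]≡0 = begin
      x *F (y +F negF 1F)                ≡⟨ x[y-z]≈xy-xz x y 1F ⟩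
      (x *F y) +F negF (x *F 1F)         ≡⟨ cong₂ (λ u v → u +F negF v) xy≡x (*-identityʳ x) ⟩
      x +F negF x                        ≡⟨ -‿inverseʳ x ⟩
      0F                                 ∎
      where
      xy≡x : x *F y ≡ x
      xy≡x = trans (cong (x ^F_) 1+[p∸1]≡p) (x^p≡x x)
  ... | inj₁ x≡0 = ⊥-elim (x≢0 x≡0)
  ... | inj₂ y-1≡0 = x∙y⁻¹≈ε⇒x≈y _ _ y-1≡0

module FiniteSums (p : ℕ) .{{_ : NonZero p}} where

  open import Data.Nat.Base using (_+_)
  open Fp p
  open ResidueRing p
  open ≡-Reasoning

  ΣF-cong : ∀ m {f g : ℕ → F} → (∀ k → k < m → f k ≡ g k) → ΣF m f ≡ ΣF m g
  ΣF-cong zero f≗g = refl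
  ΣF-cong (suc m) f≗g =
    cong₂ _+F_ (ΣF-cong m (λ k k<m → f≗g k (ℕₚ.m<n⇒m<1+n k<m))) (f≗g m (ℕₚ.n<1+n m))

  ΣF-zero : ∀ m {f : ℕ → F} → (∀ k → k < m → f k ≡ 0F) → ΣF m f ≡ 0F
  ΣF-zero zero f≗0 = refl
  ΣF-zero (suc m) f≗0 =
    trans (cong₂ _+F_ (ΣF-zero m (λ k k<m → f≗0 k (ℕₚ.m<n⇒m<1+n k<m))) (f≗0 m (ℕₚ.n<1+n m)))
          (+-identityʳ 0F)

  ΣF-+ : ∀ m (f g : ℕ → F) → ΣF m (λ k → f k +F g k) ≡ ΣF m f +F ΣF m g
  ΣF-+ zero f g = sym (+-identityʳ 0F)
  ΣF-+ (suc m) f g = trans (cong (_+F (f m +F g m)) (ΣF-+ m f g)) (+-interchange (ΣF m f) (ΣF m g) (f m) (g m))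

  *-distribˡ-ΣF : ∀ m c (f : ℕ → F) → c *F ΣF m f ≡ ΣF m (λ k → c *F f k)
  *-distribˡ-ΣF zero c f = zeroʳ c
  *-distribˡ-ΣF (suc m) c f = trans (distribˡ c _ _) (cong (_+F (c *F f m)) (*-distribˡ-ΣF m c f))

  *-distribʳ-ΣF : ∀ m c (f : ℕ → F) → ΣF m f *F c ≡ ΣF m (λ k → f k *F c)
  *-distribʳ-ΣF m c f = trans (*-comm _ c) (trans (*-distribˡ-ΣF m c f) (ΣF-cong m (λ k _ → *-comm c (f k))))

  ΣF-vanishing-tail : ∀ {N M} (f : ℕ → F) → N ≤ M → (∀ k → N ≤ k → f k ≡ 0F) → ΣF M f ≡ ΣF N f
  ΣF-vanishing-tail {N} {M} f N≤M tail≡0 =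
    trans (cong (λ m → ΣF m f) (sym (ℕₚ.m+[n∸m]≡n N≤M))) (go (M ∸ N))
    where
    go : ∀ d → ΣF (N + d) f ≡ ΣF N f
    go zero = cong (λ m → ΣF m f) (ℕₚ.+-identityʳ N)
    go (suc d) = begin
      ΣF (N + suc d) f             ≡⟨ cong (λ m → ΣF m f) (ℕₚ.+-suc N d) ⟩
      ΣF (N + d) f +F f (N + d)    ≡⟨ cong₂ _+F_ (go d) (tail≡0 (N + d) (ℕₚ.m≤m+n N d)) ⟩
      ΣF N f +F 0F                 ≡⟨ +-identityʳ _ ⟩
      ΣF N f                       ∎

  ΣF-triangle : ∀ M (g : ℕ → ℕ → F) →
                ΣF M (λ k → ΣF (suc k) (λ j → g j (k ∸ j))) ≡ ΣF M (λ j → ΣF (M ∸ j) (g j))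
  ΣF-triangle zero g = refl
  ΣF-triangle (suc M) g = begin
    ΣF M (λ k → ΣF (suc k) (λ j → g j (k ∸ j))) +F (diagonal +F g M (M ∸ M))
      ≡⟨ cong₂ (λ u v → u +F (diagonal +F g M v)) (ΣF-triangle M g) (ℕₚ.n∸n≡0 M) ⟩
    ΣF M (λ j → ΣF (M ∸ j) (g j)) +F (diagonal +F g M 0)
      ≡⟨ +-assoc _ diagonal (g M 0) ⟨
    (ΣF M (λ j → ΣF (M ∸ j) (g j)) +F diagonal) +F g M 0
      ≡⟨ cong (_+F g M 0) (ΣF-+ M (λ j → ΣF (M ∸ j) (g j)) (λ j → g j (M ∸ j))) ⟨
    ΣF M (λ j → ΣF (M ∸ j) (g j) +F g j (M ∸ j)) +F g M 0
      ≡⟨ cong₂ _+F_ (ΣF-cong M (λ j j<M → cong (λ t → ΣF t (g j)) (sym (ℕₚ.+-∸-assoc 1 (ℕₚ.<⇒≤ j<M)))))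
                    (sym (trans (cong (λ t → ΣF t (g M)) (ℕₚ.m+n∸n≡m 1 M)) (+-identityˡ (g M 0)))) ⟩
    ΣF M (λ j → ΣF (suc M ∸ j) (g j)) +F ΣF (suc M ∸ M) (g M) ∎
    where
    diagonal = ΣF M (λ j → g j (M ∸ j))

  Cauchy-product : ∀ {N N₁ N₂} (a b : ℕ → F) → N₁ + N₂ ≤ N →
                   (∀ j → N₁ < j → a j ≡ 0F) → (∀ l → N₂ < l → b l ≡ 0F) →
                   ΣF (suc N) (λ k → ΣF (suc k) (λ j → a j *F b (k ∸ j))) ≡ ΣF (suc N) a *F ΣF (suc N) b
  Cauchy-product {N} {N₁} {N₂} a b N₁+N₂≤N a≡0 b≡0 = begin
    ΣF (suc N) (λ k → ΣF (suc k) (λ j → a j *F b (k ∸ j))) ≡⟨ ΣF-triangle (suc N) (λ j l → a j *F b l) ⟩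
    ΣF (suc N) (λ j → ΣF (suc N ∸ j) (λ l → a j *F b l))  ≡⟨ ΣF-cong (suc N) (λ j _ → row j) ⟩
    ΣF (suc N) (λ j → a j *F ΣF (suc N) b)                 ≡⟨ *-distribʳ-ΣF (suc N) (ΣF (suc N) b) a ⟨
    ΣF (suc N) a *F ΣF (suc N) b                           ∎
    where
    row : ∀ j → ΣF (suc N ∸ j) (λ l → a j *F b l) ≡ a j *F ΣF (suc N) b
    row j with N₁ <? j
    ... | yes N₁<j = begin
      ΣF (suc N ∸ j) (λ l → a j *F b l)  ≡⟨ *-distribˡ-ΣF (suc N ∸ j) (a j) b ⟨
      a j *F ΣF (suc N ∸ j) b            ≡⟨ cong (_*F ΣF (suc N ∸ j) b) (a≡0 j N₁<j) ⟩
      0F *F ΣF (suc N ∸ j) b             ≡⟨ zeroˡ _ ⟩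
      0F                                 ≡⟨ zeroˡ _ ⟨
      0F *F ΣF (suc N) b                 ≡⟨ cong (_*F ΣF (suc N) b) (a≡0 j N₁<j) ⟨
      a j *F ΣF (suc N) b                ∎
    ... | no N₁≮j = begin
      ΣF (suc N ∸ j) (λ l → a j *F b l)  ≡⟨ *-distribˡ-ΣF (suc N ∸ j) (a j) b ⟨
      a j *F ΣF (suc N ∸ j) b            ≡⟨ cong (a j *F_) (ΣF-vanishing-tail b N₂<N+1-j b≡0) ⟩
      a j *F ΣF (suc N₂) b               ≡⟨ cong (a j *F_) (ΣF-vanishing-tail b N₂<N+1 b≡0) ⟨
      a j *F ΣF (suc N) b                ∎
      where
      N₂<N+1-j : suc N₂ ≤ suc N ∸ j
      N₂<N+1-j = ℕₚ.m+n≤o⇒m≤o∸n (suc N₂) (s≤s (ℕₚ.≤-trans (ℕₚ.≤-reflexive (ℕₚ.+-comm N₂ j))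
                   (ℕₚ.≤-trans (ℕₚ.+-monoˡ-≤ N₂ (ℕₚ.≮⇒≥ N₁≮j)) N₁+N₂≤N)))
      N₂<N+1 : suc N₂ ≤ suc N
      N₂<N+1 = s≤s (ℕₚ.m+n≤o⇒n≤o N₁ N₁+N₂≤N)

  _≤ᴹ_ : ∀ {n} → Monomial n → Monomial n → Set
  e ≤ᴹ B = ∀ i → e i ≤ B i

  ΣBox-cong : ∀ n (B : Monomial n) {f g : Monomial n → F} →
              (∀ e → e ≤ᴹ B → f e ≡ g e) → ΣBox n B f ≡ ΣBox n B g
  ΣBox-cong zero B f≗g = f≗g (λ ()) (λ ())
  ΣBox-cong (suc n) B f≗g = ΣF-cong (suc (B Fin.zero)) λ k k≤B₀ → ΣBox-cong n (B ∘ Fin.suc) λ e e≤B →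
    f≗g (k ∷ e) λ { Fin.zero → s≤s⁻¹ k≤B₀ ; (Fin.suc i) → e≤B i }

  ΣBox-zero : ∀ n (B : Monomial n) {f : Monomial n → F} → (∀ e → e ≤ᴹ B → f e ≡ 0F) → ΣBox n B f ≡ 0F
  ΣBox-zero zero B f≗0 = f≗0 (λ ()) (λ ())
  ΣBox-zero (suc n) B f≗0 = ΣF-zero (suc (B Fin.zero)) λ k k≤B₀ → ΣBox-zero n (B ∘ Fin.suc) λ e e≤B →
    f≗0 (k ∷ e) λ { Fin.zero → s≤s⁻¹ k≤B₀ ; (Fin.suc i) → e≤B i }

  ΣBox-+ : ∀ n (B : Monomial n) (f g : Monomial n → F) →
           ΣBox n B (λ e → f e +F g e) ≡ ΣBox n B f +F ΣBox n B g
  ΣBox-+ zero B f g = refl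
  ΣBox-+ (suc n) B f g =
    trans (ΣF-cong (suc (B Fin.zero)) λ k _ → ΣBox-+ n (B ∘ Fin.suc) (f ∘ (k ∷_)) (g ∘ (k ∷_)))
          (ΣF-+ (suc (B Fin.zero)) (λ k → ΣBox n (B ∘ Fin.suc) (f ∘ (k ∷_)))
                                   (λ k → ΣBox n (B ∘ Fin.suc) (g ∘ (k ∷_))))

  *-distribˡ-ΣBox : ∀ n (B : Monomial n) c (f : Monomial n → F) → c *F ΣBox n B f ≡ ΣBox n B (λ e → c *F f e)
  *-distribˡ-ΣBox zero B c f = refl
  *-distribˡ-ΣBox (suc n) B c f =
    trans (*-distribˡ-ΣF (suc (B Fin.zero)) c (λ k → ΣBox n (B ∘ Fin.suc) (f ∘ (k ∷_))))
          (ΣF-cong (suc (B Fin.zero)) λ k _ → *-distribˡ-ΣBox n (B ∘ Fin.suc) c (f ∘ (k ∷_)))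

  ΣBox-ΣF : ∀ n (B : Monomial n) m (h : ℕ → Monomial n → F) →
            ΣBox n B (λ e → ΣF m (λ j → h j e)) ≡ ΣF m (λ j → ΣBox n B (h j))
  ΣBox-ΣF n B zero h = ΣBox-zero n B (λ _ _ → refl)
  ΣBox-ΣF n B (suc m) h = trans (ΣBox-+ n B _ _) (cong (_+F ΣBox n B (h m)) (ΣBox-ΣF n B m h))

  ΣBox-bound-cong : ∀ n {B B′ : Monomial n} (f : Monomial n → F) →
                    (∀ i → B i ≡ B′ i) → ΣBox n B f ≡ ΣBox n B′ f
  ΣBox-bound-cong zero f B≗B′ = refl
  ΣBox-bound-cong (suc n) {B} {B′} f B≗B′ =
    trans (cong (λ m → ΣF (suc m) (λ k → ΣBox n (B ∘ Fin.suc) (f ∘ (k ∷_)))) (B≗B′ Fin.zero))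
          (ΣF-cong (suc (B′ Fin.zero)) λ k _ → ΣBox-bound-cong n (f ∘ (k ∷_)) (B≗B′ ∘ Fin.suc))

  ΠF : ∀ m → (Fin m → F) → F
  ΠF zero g = 1F
  ΠF (suc m) g = g Fin.zero *F ΠF m (g ∘ Fin.suc)

  ΠF-cong : ∀ m {g h : Fin m → F} → (∀ j → g j ≡ h j) → ΠF m g ≡ ΠF m h
  ΠF-cong zero g≗h = refl
  ΠF-cong (suc m) g≗h = cong₂ _*F_ (g≗h Fin.zero) (ΠF-cong m (g≗h ∘ Fin.suc))

module Supports (p : ℕ) .{{_ : NonZero p}} where

  open import Data.Nat.Base using (_+_)
  open Fp p
  open ResidueRing p
  open FiniteSums p

  -- Without function extensionality, the convolution in mulP only behaves well if the
  -- second factor respects pointwise equality of exponent vectors.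
  Extensional : ∀ n → Poly n → Set
  Extensional n P = ∀ {e e′} → (∀ i → e i ≡ e′ i) → P e ≡ P e′

  isZeroMon-ext : ∀ n {e e′ : Monomial n} → (∀ i → e i ≡ e′ i) → isZeroMon n e ≡ isZeroMon n e′
  isZeroMon-ext zero e≗e′ = refl
  isZeroMon-ext (suc n) {e} {e′} e≗e′ with e Fin.zero | e′ Fin.zero | e≗e′ Fin.zero
  ... | zero  | .zero  | refl = isZeroMon-ext n (e≗e′ ∘ Fin.suc)
  ... | suc _ | .suc _ | refl = refl

  constP-ext : ∀ n c → Extensional n (constP n c)
  constP-ext n c e≗e′ = cong (λ b → if b then c else 0F) (isZeroMon-ext n e≗e′)

  mulP-ext : ∀ n P Q → Extensional n Q → Extensional n (mulP n P Q)
  mulP-ext n P Q Q-ext {e} {e′} e≗e′ = trans (ΣBox-bound-cong n _ e≗e′)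
    (ΣBox-cong n e′ λ e₁ _ → cong (P e₁ *F_) (Q-ext λ i → cong (_∸ e₁ i) (e≗e′ i)))

  powP-ext : ∀ n P m → Extensional n (powP n P m)
  powP-ext n P zero = constP-ext n 1F
  powP-ext n P (suc m) = mulP-ext n P (powP n P m) (powP-ext n P m)

  prodFinP-ext : ∀ n m Ps → Extensional n (prodFinP n m Ps)
  prodFinP-ext n zero Ps = constP-ext n 1F
  prodFinP-ext n (suc m) Ps = mulP-ext n (Ps Fin.zero) _ (prodFinP-ext n m (Ps ∘ Fin.suc))

  Supported : ∀ n → Monomial n → Poly n → Set
  Supported n B P = ∀ e → (∃ λ i → B i < e i) → P e ≡ 0F

  Supported-mono : ∀ n {B B′} P → (∀ i → B i ≤ B′ i) → Supported n B P → Supported n B′ P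
  Supported-mono n P B≤B′ P⊆B e (i , B′<e) = P⊆B e (i , ℕₚ.≤-<-trans (B≤B′ i) B′<e)

  isZeroMon-false : ∀ n (e : Monomial n) i → 0 < e i → isZeroMon n e ≡ false
  isZeroMon-false (suc n) e Fin.zero 0<e₀ with e Fin.zero | 0<e₀
  ... | suc _ | _ = refl
  isZeroMon-false (suc n) e (Fin.suc i) 0<eᵢ with e Fin.zero
  ... | zero = isZeroMon-false n (e ∘ Fin.suc) i 0<eᵢ
  ... | suc _ = refl

  Supported-const : ∀ n B c → Supported n B (constP n c)
  Supported-const n B c e (i , B<eᵢ) rewrite isZeroMon-false n e i (ℕₚ.≤-<-trans z≤n B<eᵢ) = refl

  Supported-+ : ∀ n B P Q → Supported n B P → Supported n B Q → Supported n B (addP n P Q)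
  Supported-+ n B P Q P⊆B Q⊆B e out = trans (cong₂ _+F_ (P⊆B e out) (Q⊆B e out)) (+-identityʳ 0F)

  Supported-− : ∀ n B P Q → Supported n B P → Supported n B Q → Supported n B (subP n P Q)
  Supported-− n B P Q P⊆B Q⊆B e out =
    trans (cong₂ _-F_ (P⊆B e out) (Q⊆B e out)) (trans (-F≡+negF 0F 0F) (-‿inverseʳ 0F))

  Supported-* : ∀ n B₁ B₂ P Q → Supported n B₁ P → Supported n B₂ Q →
                Supported n (λ i → B₁ i + B₂ i) (mulP n P Q)
  Supported-* n B₁ B₂ P Q P⊆B₁ Q⊆B₂ e (i , B₁+B₂<eᵢ) = ΣBox-zero n e term≡0
    where
    term≡0 : ∀ e₁ → e₁ ≤ᴹ e → P e₁ *F Q (λ i → e i ∸ e₁ i) ≡ 0F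
    term≡0 e₁ _ with B₁ i <? e₁ i
    ... | yes B₁<e₁ = trans (cong (_*F _) (P⊆B₁ e₁ (i , B₁<e₁))) (zeroˡ _)
    ... | no B₁≮e₁ = trans (cong (P e₁ *F_) (Q⊆B₂ _ (i , B₂<eᵢ-e₁ᵢ))) (zeroʳ (P e₁))
      where
      B₂<eᵢ-e₁ᵢ : B₂ i < e i ∸ e₁ i
      B₂<eᵢ-e₁ᵢ = ℕₚ.m+n≤o⇒m≤o∸n (suc (B₂ i)) (ℕₚ.≤-trans (s≤s B₂+e₁≤B₁+B₂) B₁+B₂<eᵢ)
        where
        B₂+e₁≤B₁+B₂ : B₂ i + e₁ i ≤ B₁ i + B₂ i
        B₂+e₁≤B₁+B₂ = ℕₚ.≤-trans (ℕₚ.≤-reflexive (ℕₚ.+-comm (B₂ i) (e₁ i)))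
                                 (ℕₚ.+-monoˡ-≤ (B₂ i) (ℕₚ.≮⇒≥ B₁≮e₁))

  Supported-sumP : ∀ n B m Ps → (∀ k → Supported n B (Ps k)) → Supported n B (sumP n m Ps)
  Supported-sumP n B zero Ps Ps⊆B = Supported-const n B 0F
  Supported-sumP n B (suc m) Ps Ps⊆B = Supported-+ n B _ _ (Supported-sumP n B m Ps Ps⊆B) (Ps⊆B m)

  axisBox : ∀ {n} → ℕ → ℕ → Monomial n
  axisBox zero    d Fin.zero    = d
  axisBox zero    d (Fin.suc i) = 0
  axisBox (suc c) d Fin.zero    = 0
  axisBox (suc c) d (Fin.suc i) = axisBox c d i

  upperBox : ∀ {n} → ℕ → ℕ → Monomial n
  upperBox zero    d i           = d
  upperBox (suc c) d Fin.zero    = 0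
  upperBox (suc c) d (Fin.suc i) = upperBox c d i

  axisBox-≤ : ∀ {n} c d (i : Fin n) → axisBox c d i ≤ d
  axisBox-≤ zero    d Fin.zero    = ℕₚ.≤-refl
  axisBox-≤ zero    d (Fin.suc i) = z≤n
  axisBox-≤ (suc c) d Fin.zero    = z≤n
  axisBox-≤ (suc c) d (Fin.suc i) = axisBox-≤ c d i

  axisBox-+ : ∀ {n} c d d′ (i : Fin n) → axisBox c d i + axisBox c d′ i ≡ axisBox c (d + d′) i
  axisBox-+ zero    d d′ Fin.zero    = refl
  axisBox-+ zero    d d′ (Fin.suc i) = refl
  axisBox-+ (suc c) d d′ Fin.zero    = refl
  axisBox-+ (suc c) d d′ (Fin.suc i) = axisBox-+ c d d′ i

  axisBox+upperBox≡upperBox : ∀ {n} c d (i : Fin n) → axisBox c d i + upperBox (suc c) d i ≡ upperBox c d i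
  axisBox+upperBox≡upperBox zero    d Fin.zero    = ℕₚ.+-identityʳ d
  axisBox+upperBox≡upperBox zero    d (Fin.suc i) = refl
  axisBox+upperBox≡upperBox (suc c) d Fin.zero    = refl
  axisBox+upperBox≡upperBox (suc c) d (Fin.suc i) = axisBox+upperBox≡upperBox c d i

  axisBox-≤-suc : ∀ {n} c m (i : Fin n) → axisBox c m i ≤ axisBox c (suc m) i
  axisBox-≤-suc c m i = ℕₚ.≤-trans (ℕₚ.m≤n+m _ _) (ℕₚ.≤-reflexive (axisBox-+ c 1 m i))

  upperBox-suc-≤ : ∀ {n} c d (i : Fin n) → upperBox (suc c) d i ≤ upperBox c d i
  upperBox-suc-≤ c d i = ℕₚ.≤-trans (ℕₚ.m≤n+m _ _) (ℕₚ.≤-reflexive (axisBox+upperBox≡upperBox c d i))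

  isVarMon-false : ∀ n i (e : Monomial n) j → axisBox (toℕ i) 1 j < e j → isVarMon n i e ≡ false
  isVarMon-false (suc n) Fin.zero e Fin.zero 1<e₀ with e Fin.zero | 1<e₀
  ... | suc (suc _) | _ = refl
  ... | suc zero | s≤s ()
  isVarMon-false (suc n) Fin.zero e (Fin.suc j) 0<eⱼ with e Fin.zero
  ... | zero = refl
  ... | suc zero = isZeroMon-false n (e ∘ Fin.suc) j 0<eⱼ
  ... | suc (suc _) = refl
  isVarMon-false (suc n) (Fin.suc i) e Fin.zero 0<e₀ with e Fin.zero | 0<e₀
  ... | suc _ | _ = refl
  isVarMon-false (suc n) (Fin.suc i) e (Fin.suc j) eⱼ>axis with e Fin.zero
  ... | zero = isVarMon-false n i (e ∘ Fin.suc) j eⱼ>axis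
  ... | suc _ = refl

  Supported-var : ∀ n i → Supported n (axisBox (toℕ i) 1) (varP n i)
  Supported-var n i e (j , eⱼ>axis) rewrite isVarMon-false n i e j eⱼ>axis = refl

  Supported-^ : ∀ n c P m → Supported n (axisBox c 1) P → Supported n (axisBox c m) (powP n P m)
  Supported-^ n c P zero P⊆axis = Supported-const n _ 1F
  Supported-^ n c P (suc m) P⊆axis = Supported-mono n _ (λ i → ℕₚ.≤-reflexive (axisBox-+ c 1 m i))
    (Supported-* n _ _ P _ P⊆axis (Supported-^ n c P m P⊆axis))

  -- The j-th factor involves only the variable c + j; the offset c follows prodFinP into the tail.
  AxisSupported : ∀ n m → ℕ → ℕ → (Fin m → Poly n) → Set
  AxisSupported n m c d Ps = ∀ j → Supported n (axisBox (c + toℕ j) d) (Ps j)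

  AxisSupported-head : ∀ n m c d Ps → AxisSupported n (suc m) c d Ps → Supported n (axisBox c d) (Ps Fin.zero)
  AxisSupported-head n m c d Ps Ps⊆axes =
    subst (λ c′ → Supported n (axisBox c′ d) (Ps Fin.zero)) (ℕₚ.+-identityʳ c) (Ps⊆axes Fin.zero)

  AxisSupported-tail : ∀ n m c d Ps → AxisSupported n (suc m) c d Ps → AxisSupported n m (suc c) d (Ps ∘ Fin.suc)
  AxisSupported-tail n m c d Ps Ps⊆axes j =
    subst (λ c′ → Supported n (axisBox c′ d) (Ps (Fin.suc j))) (ℕₚ.+-suc c (toℕ j)) (Ps⊆axes (Fin.suc j))

  Supported-prodFinP : ∀ n m c d Ps → AxisSupported n m c d Ps → Supported n (upperBox c d) (prodFinP n m Ps)
  Supported-prodFinP n zero c d Ps _ = Supported-const n _ 1F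
  Supported-prodFinP n (suc m) c d Ps Ps⊆axes =
    Supported-mono n _ (λ i → ℕₚ.≤-reflexive (axisBox+upperBox≡upperBox c d i))
      (Supported-* n _ _ _ _ (AxisSupported-head n m c d Ps Ps⊆axes)
        (Supported-prodFinP n m (suc c) d (Ps ∘ Fin.suc) (AxisSupported-tail n m c d Ps Ps⊆axes)))

  Supported-L : ∀ n t i → Supported n (axisBox (toℕ i) (p ∸ 1)) (L n t i)
  Supported-L n t i = Supported-sumP n _ t _ λ k → Supported-− n _ _ _
    (Supported-const n _ 1F)
    (Supported-^ n (toℕ i) _ (p ∸ 1)
      (Supported-− n _ _ _ (Supported-var n i) (Supported-const n _ ⟦ k ⟧)))

  fullBox : ∀ {n} → Monomial n
  fullBox _ = p ∸ 1

  Supported-maxPoly : ∀ n → Supported n fullBox (maxPoly n)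
  Supported-maxPoly n = Supported-sumP n _ (p ∸ 1) _ λ k → Supported-− n _ _ _
    (Supported-const n _ 1F)
    (Supported-prodFinP n n 0 (p ∸ 1) (L n (suc k)) (Supported-L n (suc k)))

  maxPoly-reduced : ∀ n → Reduced n (maxPoly n)
  maxPoly-reduced n e (i , p≤eᵢ) =
    Supported-maxPoly n e (i , ℕₚ.≤-trans (ℕₚ.≤-reflexive (ℕₚ.m+[n∸m]≡n (>-nonZero⁻¹ p))) p≤eᵢ)

module Evaluation (p : ℕ) .{{_ : NonZero p}} where

  open import Data.Nat.Base using (_+_)
  open Fp p
  open ResidueRing p
  open FiniteSums p
  open Supports p
  open ≡-Reasoning

  monomial : ∀ {n} → (Fin n → F) → Monomial n → F
  monomial {zero} x e = 1F
  monomial {suc n} x e = (x Fin.zero ^F e Fin.zero) *F monomial (x ∘ Fin.suc) (e ∘ Fin.suc)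

  -- A Poly has infinitely many coefficients, so evaluation is always truncated to a box.
  evalBox : ∀ n → Monomial n → Poly n → (Fin n → F) → F
  evalBox n B P x = ΣBox n B (λ e → P e *F monomial x e)

  slice : ∀ {n} → Poly (suc n) → ℕ → Poly n
  slice P k e = P (k ∷ e)

  private
    pull-power : ∀ n (B : Monomial (suc n)) (P : Poly (suc n)) y (W : ℕ → Monomial n → F) →
      ΣF (suc (B Fin.zero)) (λ k → ΣBox n (B ∘ Fin.suc) (λ e → P (k ∷ e) *F ((y ^F k) *F W k e)))
      ≡ ΣF (suc (B Fin.zero)) (λ k → (y ^F k) *F ΣBox n (B ∘ Fin.suc) (λ e → P (k ∷ e) *F W k e))
    pull-power n B P y W = ΣF-cong (suc (B Fin.zero)) λ k _ →
      trans (ΣBox-cong n (B ∘ Fin.suc) λ e _ → x*[y*z]≡y*[x*z] (P (k ∷ e)) (y ^F k) (W k e))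
            (sym (*-distribˡ-ΣBox n (B ∘ Fin.suc) (y ^F k) _))

  evalBox-suc : ∀ n B P x → evalBox (suc n) B P x ≡
    ΣF (suc (B Fin.zero)) (λ k → (x Fin.zero ^F k) *F evalBox n (B ∘ Fin.suc) (slice P k) (x ∘ Fin.suc))
  evalBox-suc n B P x = pull-power n B P (x Fin.zero) (λ _ → monomial (x ∘ Fin.suc))

  evalReduced≡evalBox : ∀ n P x → evalReduced n P x ≡ evalBox n fullBox P x
  evalReduced≡evalBox zero P x = refl
  evalReduced≡evalBox (suc n) P x = begin
    evalReduced (suc n) P x
      ≡⟨ pull-power n fullBox P (x Fin.zero) _ ⟩
    ΣF p′ (λ k → (x Fin.zero ^F k) *F evalReduced n (slice P k) (x ∘ Fin.suc))
      ≡⟨ ΣF-cong p′ (λ k _ → cong ((x Fin.zero ^F k) *F_) (evalReduced≡evalBox n (slice P k) (x ∘ Fin.suc))) ⟩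
    ΣF p′ (λ k → (x Fin.zero ^F k) *F evalBox n fullBox (slice P k) (x ∘ Fin.suc))
      ≡⟨ evalBox-suc n fullBox P x ⟨
    evalBox (suc n) fullBox P x ∎
    where p′ = suc (p ∸ 1)

  evalBox-zero : ∀ n B P x → (∀ e → P e ≡ 0F) → evalBox n B P x ≡ 0F
  evalBox-zero n B P x P≡0 = ΣBox-zero n B λ e _ → trans (cong (_*F monomial x e) (P≡0 e)) (zeroˡ _)

  evalBox-suc-truncated : ∀ n B P x N → N ≤ suc (B Fin.zero) → (∀ k → N ≤ k → ∀ e → P (k ∷ e) ≡ 0F) →
    evalBox (suc n) B P x ≡ ΣF N (λ k → (x Fin.zero ^F k) *F evalBox n (B ∘ Fin.suc) (slice P k) (x ∘ Fin.suc))
  evalBox-suc-truncated n B P x N N≤ high≡0 = trans (evalBox-suc n B P x) (ΣF-vanishing-tail _ N≤ λ k N≤k →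
    trans (cong ((x Fin.zero ^F k) *F_) (evalBox-zero n (B ∘ Fin.suc) (slice P k) (x ∘ Fin.suc) (high≡0 k N≤k)))
          (zeroʳ (x Fin.zero ^F k)))

  evalBox-const : ∀ n B c x → evalBox n B (constP n c) x ≡ c
  evalBox-const zero B c x = *-identityʳ c
  evalBox-const (suc n) B c x = begin
    evalBox (suc n) B (constP (suc n) c) x
      ≡⟨ evalBox-suc-truncated n B (constP (suc n) c) x 1 (s≤s z≤n) (λ { (suc k) _ e → refl }) ⟩
    0F +F (1F *F evalBox n (B ∘ Fin.suc) (constP n c) (x ∘ Fin.suc))
      ≡⟨ trans (+-identityˡ _) (*-identityˡ _) ⟩
    evalBox n (B ∘ Fin.suc) (constP n c) (x ∘ Fin.suc)
      ≡⟨ evalBox-const n (B ∘ Fin.suc) c (x ∘ Fin.suc) ⟩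
    c ∎

  evalBox-var : ∀ n B i x → 1 ≤ B i → evalBox n B (varP n i) x ≡ x i
  evalBox-var (suc n) B Fin.zero x 1≤B₀ = begin
    evalBox (suc n) B (varP (suc n) Fin.zero) x
      ≡⟨ evalBox-suc-truncated n B (varP (suc n) Fin.zero) x 2 (s≤s 1≤B₀)
           (λ { (suc (suc k)) _ e → refl ; (suc zero) (s≤s ()) }) ⟩
    (0F +F (1F *F evalBox n B′ (λ _ → 0F) x′)) +F ((x Fin.zero *F 1F) *F evalBox n B′ (constP n 1F) x′)
      ≡⟨ cong₂ (λ u v → (0F +F (1F *F u)) +F ((x Fin.zero *F 1F) *F v))
               (evalBox-zero n B′ (λ _ → 0F) x′ (λ _ → refl)) (evalBox-const n B′ 1F x′) ⟩
    (0F +F (1F *F 0F)) +F ((x Fin.zero *F 1F) *F 1F)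
      ≡⟨ cong₂ _+F_ (trans (+-identityˡ _) (zeroʳ 1F)) (trans (*-identityʳ _) (*-identityʳ _)) ⟩
    0F +F x Fin.zero
      ≡⟨ +-identityˡ _ ⟩
    x Fin.zero ∎
    where
    B′ = B ∘ Fin.suc
    x′ = x ∘ Fin.suc
  evalBox-var (suc n) B (Fin.suc i) x 1≤Bᵢ = begin
    evalBox (suc n) B (varP (suc n) (Fin.suc i)) x
      ≡⟨ evalBox-suc-truncated n B (varP (suc n) (Fin.suc i)) x 1 (s≤s z≤n) (λ { (suc k) _ e → refl }) ⟩
    0F +F (1F *F evalBox n (B ∘ Fin.suc) (varP n i) (x ∘ Fin.suc))
      ≡⟨ trans (+-identityˡ _) (*-identityˡ _) ⟩
    evalBox n (B ∘ Fin.suc) (varP n i) (x ∘ Fin.suc)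
      ≡⟨ evalBox-var n (B ∘ Fin.suc) i (x ∘ Fin.suc) 1≤Bᵢ ⟩
    x (Fin.suc i) ∎

  evalBox-+ : ∀ n B P Q x → evalBox n B (addP n P Q) x ≡ evalBox n B P x +F evalBox n B Q x
  evalBox-+ n B P Q x = trans (ΣBox-cong n B λ e _ → distribʳ (monomial x e) (P e) (Q e))
                              (ΣBox-+ n B (λ e → P e *F monomial x e) (λ e → Q e *F monomial x e))

  ΣBox-negF : ∀ n B (f : Monomial n → F) → ΣBox n B (λ e → negF (f e)) ≡ negF (ΣBox n B f)
  ΣBox-negF n B f = begin
    ΣBox n B (λ e → negF (f e))            ≡⟨ ΣBox-cong n B (λ e _ → -1*x≈-x (f e)) ⟨
    ΣBox n B (λ e → negF 1F *F f e)        ≡⟨ *-distribˡ-ΣBox n B (negF 1F) f ⟨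
    negF 1F *F ΣBox n B f                  ≡⟨ -1*x≈-x _ ⟩
    negF (ΣBox n B f)                      ∎

  evalBox-− : ∀ n B P Q x → evalBox n B (subP n P Q) x ≡ evalBox n B P x -F evalBox n B Q x
  evalBox-− n B P Q x = begin
    ΣBox n B (λ e → (P e -F Q e) *F monomial x e)
      ≡⟨ ΣBox-cong n B (λ e _ → trans (cong (_*F monomial x e) (-F≡+negF (P e) (Q e)))
                                      ([y-z]x≈yx-zx (monomial x e) (P e) (Q e))) ⟩
    ΣBox n B (λ e → (P e *F monomial x e) +F negF (Q e *F monomial x e))
      ≡⟨ ΣBox-+ n B _ _ ⟩
    evalBox n B P x +F ΣBox n B (λ e → negF (Q e *F monomial x e))
      ≡⟨ cong (evalBox n B P x +F_) (ΣBox-negF n B _) ⟩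
    evalBox n B P x +F negF (evalBox n B Q x)
      ≡⟨ -F≡+negF (evalBox n B P x) (evalBox n B Q x) ⟨
    evalBox n B P x -F evalBox n B Q x ∎

  evalBox-sumP : ∀ n B m Ps x → evalBox n B (sumP n m Ps) x ≡ ΣF m (λ k → evalBox n B (Ps k) x)
  evalBox-sumP n B zero Ps x = evalBox-const n B 0F x
  evalBox-sumP n B (suc m) Ps x =
    trans (evalBox-+ n B (sumP n m Ps) (Ps m) x) (cong (_+F evalBox n B (Ps m) x) (evalBox-sumP n B m Ps x))

  evalBox-ΣF : ∀ n B m (Ps : ℕ → Poly n) x →
               evalBox n B (λ e → ΣF m (λ j → Ps j e)) x ≡ ΣF m (λ j → evalBox n B (Ps j) x)
  evalBox-ΣF n B m Ps x = trans (ΣBox-cong n B λ e _ → *-distribʳ-ΣF m (monomial x e) (λ j → Ps j e))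
                                (ΣBox-ΣF n B m (λ j e → Ps j e *F monomial x e))

  mulP-slice : ∀ n P Q → Extensional (suc n) Q → ∀ k e →
               mulP (suc n) P Q (k ∷ e) ≡ ΣF (suc k) (λ j → mulP n (slice P j) (slice Q (k ∸ j)) e)
  mulP-slice n P Q Q-ext k e = ΣF-cong (suc k) λ j _ → ΣBox-cong n e λ e₁ _ →
    cong (P (j ∷ e₁) *F_) (Q-ext λ { Fin.zero → refl ; (Fin.suc i) → refl })

  evalBox-* : ∀ n B B₁ B₂ P Q x → Extensional n Q → Supported n B₁ P → Supported n B₂ Q →
              (∀ i → B₁ i + B₂ i ≤ B i) → evalBox n B (mulP n P Q) x ≡ evalBox n B P x *F evalBox n B Q x
  evalBox-* zero B B₁ B₂ P Q x Q-ext _ _ _ =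
    trans (*-identityʳ (mulP zero P Q (λ ())))
          (trans (cong (P (λ ()) *F_) (Q-ext λ ()))
                 (sym (cong₂ _*F_ (*-identityʳ (P (λ ()))) (*-identityʳ (Q (λ ()))))))
  evalBox-* (suc n) B B₁ B₂ P Q x Q-ext P⊆B₁ Q⊆B₂ B₁+B₂≤B = begin
    evalBox (suc n) B (mulP (suc n) P Q) x
      ≡⟨ evalBox-suc n B (mulP (suc n) P Q) x ⟩
    ΣF (suc (B Fin.zero)) (λ k → (x₀ ^F k) *F evalBox n B′ (slice (mulP (suc n) P Q) k) x′)
      ≡⟨ ΣF-cong (suc (B Fin.zero)) (λ k _ → coefficient k) ⟩
    ΣF (suc (B Fin.zero)) (λ k → ΣF (suc k) (λ j → a j *F b (k ∸ j)))
      ≡⟨ Cauchy-product a b (B₁+B₂≤B Fin.zero) a-vanishes b-vanishes ⟩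
    ΣF (suc (B Fin.zero)) a *F ΣF (suc (B Fin.zero)) b
      ≡⟨ cong₂ _*F_ (evalBox-suc n B P x) (evalBox-suc n B Q x) ⟨
    evalBox (suc n) B P x *F evalBox (suc n) B Q x ∎
    where
    x₀ = x Fin.zero
    x′ = x ∘ Fin.suc
    B′ = B ∘ Fin.suc

    evalP evalQ a b : ℕ → F
    evalP j = evalBox n B′ (slice P j) x′
    evalQ l = evalBox n B′ (slice Q l) x′
    a j = (x₀ ^F j) *F evalP j
    b l = (x₀ ^F l) *F evalQ l

    a-vanishes : ∀ j → B₁ Fin.zero < j → a j ≡ 0F
    a-vanishes j B₁<j = trans (cong ((x₀ ^F j) *F_)
      (evalBox-zero n B′ (slice P j) x′ λ e → P⊆B₁ (j ∷ e) (Fin.zero , B₁<j))) (zeroʳ (x₀ ^F j))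

    b-vanishes : ∀ l → B₂ Fin.zero < l → b l ≡ 0F
    b-vanishes l B₂<l = trans (cong ((x₀ ^F l) *F_)
      (evalBox-zero n B′ (slice Q l) x′ λ e → Q⊆B₂ (l ∷ e) (Fin.zero , B₂<l))) (zeroʳ (x₀ ^F l))

    slice-evalBox-* : ∀ j l → evalBox n B′ (mulP n (slice P j) (slice Q l)) x′ ≡ evalP j *F evalQ l
    slice-evalBox-* j l = evalBox-* n B′ (B₁ ∘ Fin.suc) (B₂ ∘ Fin.suc) (slice P j) (slice Q l) x′
      (λ e≗e′ → Q-ext λ { Fin.zero → refl ; (Fin.suc i) → e≗e′ i })
      (λ e (i , out) → P⊆B₁ (j ∷ e) (Fin.suc i , out))
      (λ e (i , out) → Q⊆B₂ (l ∷ e) (Fin.suc i , out))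
      (B₁+B₂≤B ∘ Fin.suc)

    coefficient : ∀ k → (x₀ ^F k) *F evalBox n B′ (slice (mulP (suc n) P Q) k) x′ ≡
                        ΣF (suc k) (λ j → a j *F b (k ∸ j))
    coefficient k = begin
      (x₀ ^F k) *F evalBox n B′ (slice (mulP (suc n) P Q) k) x′
        ≡⟨ cong ((x₀ ^F k) *F_) (ΣBox-cong n B′ λ e _ → cong (_*F monomial x′ e) (mulP-slice n P Q Q-ext k e)) ⟩
      (x₀ ^F k) *F evalBox n B′ (λ e → ΣF (suc k) (λ j → mulP n (slice P j) (slice Q (k ∸ j)) e)) x′
        ≡⟨ cong ((x₀ ^F k) *F_) (evalBox-ΣF n B′ (suc k) (λ j → mulP n (slice P j) (slice Q (k ∸ j))) x′) ⟩
      (x₀ ^F k) *F ΣF (suc k) (λ j → evalBox n B′ (mulP n (slice P j) (slice Q (k ∸ j))) x′)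
        ≡⟨ cong ((x₀ ^F k) *F_) (ΣF-cong (suc k) λ j _ → slice-evalBox-* j (k ∸ j)) ⟩
      (x₀ ^F k) *F ΣF (suc k) (λ j → evalP j *F evalQ (k ∸ j))
        ≡⟨ *-distribˡ-ΣF (suc k) (x₀ ^F k) _ ⟩
      ΣF (suc k) (λ j → (x₀ ^F k) *F (evalP j *F evalQ (k ∸ j)))
        ≡⟨ ΣF-cong (suc k) (λ j j≤k → split j (s≤s⁻¹ j≤k)) ⟩
      ΣF (suc k) (λ j → a j *F b (k ∸ j)) ∎
      where
      split : ∀ j → j ≤ k → (x₀ ^F k) *F (evalP j *F evalQ (k ∸ j)) ≡ a j *F b (k ∸ j)
      split j j≤k = begin
        (x₀ ^F k) *F (evalP j *F evalQ (k ∸ j))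
          ≡⟨ cong (λ m → (x₀ ^F m) *F (evalP j *F evalQ (k ∸ j))) (ℕₚ.m+[n∸m]≡n j≤k) ⟨
        (x₀ ^F (j + (k ∸ j))) *F (evalP j *F evalQ (k ∸ j))
          ≡⟨ cong (_*F (evalP j *F evalQ (k ∸ j))) (^F-+ x₀ j (k ∸ j)) ⟩
        ((x₀ ^F j) *F (x₀ ^F (k ∸ j))) *F (evalP j *F evalQ (k ∸ j))
          ≡⟨ *-interchange (x₀ ^F j) (x₀ ^F (k ∸ j)) (evalP j) (evalQ (k ∸ j)) ⟩
        a j *F b (k ∸ j) ∎

  evalBox-^ : ∀ n B c P m x → Supported n (axisBox c 1) P → (∀ i → axisBox c m i ≤ B i) →
              evalBox n B (powP n P m) x ≡ evalBox n B P x ^F m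
  evalBox-^ n B c P zero x _ _ = evalBox-const n B 1F x
  evalBox-^ n B c P (suc m) x P⊆axis axis≤B =
    trans (evalBox-* n B (axisBox c 1) (axisBox c m) P (powP n P m) x (powP-ext n P m) P⊆axis
                     (Supported-^ n c P m P⊆axis)
                     (λ i → ℕₚ.≤-trans (ℕₚ.≤-reflexive (axisBox-+ c 1 m i)) (axis≤B i)))
          (cong (evalBox n B P x *F_)
                (evalBox-^ n B c P m x P⊆axis λ i → ℕₚ.≤-trans (axisBox-≤-suc c m i) (axis≤B i)))

  evalBox-prodFinP : ∀ n B m c d Ps x → AxisSupported n m c d Ps → (∀ i → upperBox c d i ≤ B i) →
                     evalBox n B (prodFinP n m Ps) x ≡ ΠF m (λ j → evalBox n B (Ps j) x)
  evalBox-prodFinP n B zero c d Ps x _ _ = evalBox-const n B 1F x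
  evalBox-prodFinP n B (suc m) c d Ps x Ps⊆axes upper≤B =
    trans (evalBox-* n B (axisBox c d) (upperBox (suc c) d) (Ps Fin.zero) (prodFinP n m (Ps ∘ Fin.suc)) x
                     (prodFinP-ext n m (Ps ∘ Fin.suc)) (AxisSupported-head n m c d Ps Ps⊆axes)
                     (Supported-prodFinP n m (suc c) d (Ps ∘ Fin.suc) tail⊆axes)
                     (λ i → ℕₚ.≤-trans (ℕₚ.≤-reflexive (axisBox+upperBox≡upperBox c d i)) (upper≤B i)))
          (cong (evalBox n B (Ps Fin.zero) x *F_) (evalBox-prodFinP n B m (suc c) d (Ps ∘ Fin.suc) x tail⊆axes
                     λ i → ℕₚ.≤-trans (upperBox-suc-≤ c d i) (upper≤B i)))
    where
    tail⊆axes = AxisSupported-tail n m c d Ps Ps⊆axes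

module Indicators (p : ℕ) .{{_ : NonZero p}} where

  open import Data.Nat.Base using (_+_; _⊓_; _≤ᵇ_)
  open import Data.Fin.Properties using (any?)
  open Fp p
  open ResidueRing p
  open FiniteSums p using (ΣF-cong; ΠF)
  open ≡-Reasoning

  χ-true : ∀ {A : Set} (A? : Dec A) → A → χ ⌊ A? ⌋ ≡ 1F
  χ-true (yes _) _ = refl
  χ-true (no ¬a) a = ⊥-elim (¬a a)

  χ-false : ∀ {A : Set} (A? : Dec A) → ¬ A → χ ⌊ A? ⌋ ≡ 0F
  χ-false (yes a) ¬a = ⊥-elim (¬a a)
  χ-false (no _) _ = refl

  χ-⇔ : ∀ {A B : Set} (A? : Dec A) (B? : Dec B) → (A → B) → (B → A) → χ ⌊ A? ⌋ ≡ χ ⌊ B? ⌋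
  χ-⇔ (yes a) B? A→B _ = sym (χ-true B? (A→B a))
  χ-⇔ (no ¬a) B? _ B→A = sym (χ-false B? (¬a ∘ B→A))

  χ[a<t]+χ[a≡t]≡χ[a<1+t] : ∀ a t → χ ⌊ a <? t ⌋ +F χ ⌊ a ≟ t ⌋ ≡ χ ⌊ a <? suc t ⌋
  χ[a<t]+χ[a≡t]≡χ[a<1+t] a t with ℕₚ.<-cmp a t
  ... | tri< a<t a≢t _ = begin
    χ ⌊ a <? t ⌋ +F χ ⌊ a ≟ t ⌋  ≡⟨ cong₂ _+F_ (χ-true (a <? t) a<t) (χ-false (a ≟ t) a≢t) ⟩
    1F +F 0F                     ≡⟨ +-identityʳ 1F ⟩
    1F                           ≡⟨ χ-true (a <? suc t) (ℕₚ.m<n⇒m<1+n a<t) ⟨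
    χ ⌊ a <? suc t ⌋             ∎
  ... | tri≈ a≮t a≡t _ = begin
    χ ⌊ a <? t ⌋ +F χ ⌊ a ≟ t ⌋  ≡⟨ cong₂ _+F_ (χ-false (a <? t) a≮t) (χ-true (a ≟ t) a≡t) ⟩
    0F +F 1F                     ≡⟨ +-identityˡ 1F ⟩
    1F                           ≡⟨ χ-true (a <? suc t) (s≤s (ℕₚ.≤-reflexive a≡t)) ⟨
    χ ⌊ a <? suc t ⌋             ∎
  ... | tri> a≮t a≢t t<a = begin
    χ ⌊ a <? t ⌋ +F χ ⌊ a ≟ t ⌋  ≡⟨ cong₂ _+F_ (χ-false (a <? t) a≮t) (χ-false (a ≟ t) a≢t) ⟩
    0F +F 0F                     ≡⟨ +-identityˡ 0F ⟩
    0F                           ≡⟨ χ-false (a <? suc t) (ℕₚ.<⇒≱ t<a ∘ s≤s⁻¹) ⟨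
    χ ⌊ a <? suc t ⌋             ∎

  Σχ[a≡k]≡χ[a<t] : ∀ a t → ΣF t (λ k → χ ⌊ a ≟ k ⌋) ≡ χ ⌊ a <? t ⌋
  Σχ[a≡k]≡χ[a<t] a zero = sym (χ-false (a <? 0) λ ())
  Σχ[a≡k]≡χ[a<t] a (suc t) =
    trans (cong (_+F χ ⌊ a ≟ t ⌋) (Σχ[a≡k]≡χ[a<t] a t)) (χ[a<t]+χ[a≡t]≡χ[a<1+t] a t)

  Πχ[xⱼ<t]≡1-χsome≥ : ∀ n t (x : Fin n → F) → ΠF n (λ j → χ ⌊ toℕ (x j) <? t ⌋) ≡ 1F -F χsome≥ n t x
  Πχ[xⱼ<t]≡1-χsome≥ zero t x = begin
    1F                      ≡⟨ +-identityʳ 1F ⟨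
    1F +F 0F                ≡⟨ cong (1F +F_) -0#≈0# ⟨
    1F +F negF 0F           ≡⟨ -F≡+negF 1F 0F ⟨
    1F -F 0F                ≡⟨ cong (1F -F_) (χ-false (any? (λ i → t ≤? toℕ (x i))) λ ()) ⟨
    1F -F χsome≥ zero t x   ∎
  Πχ[xⱼ<t]≡1-χsome≥ (suc n) t x = by-cases (t ≤? toℕ (x Fin.zero))
    where
    x₀ = x Fin.zero
    rest = ΠF n (λ j → χ ⌊ toℕ (x (Fin.suc j)) <? t ⌋)
    by-cases : Dec (t ≤ toℕ x₀) → χ ⌊ toℕ x₀ <? t ⌋ *F rest ≡ 1F -F χsome≥ (suc n) t x
    by-cases (yes t≤x₀) = begin
      χ ⌊ toℕ x₀ <? t ⌋ *F rest       ≡⟨ cong (_*F rest) (χ-false (toℕ x₀ <? t) (ℕₚ.≤⇒≯ t≤x₀)) ⟩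
      0F *F rest                      ≡⟨ zeroˡ rest ⟩
      0F                              ≡⟨ trans (-F≡+negF 1F 1F) (-‿inverseʳ 1F) ⟨
      1F -F 1F                        ≡⟨ cong (1F -F_) (χ-true (any? (λ i → t ≤? toℕ (x i))) (Fin.zero , t≤x₀)) ⟨
      1F -F χsome≥ (suc n) t x        ∎
    by-cases (no t≰x₀) = begin
      χ ⌊ toℕ x₀ <? t ⌋ *F rest
        ≡⟨ cong₂ _*F_ (χ-true (toℕ x₀ <? t) (ℕₚ.≰⇒> t≰x₀))
                      (Πχ[xⱼ<t]≡1-χsome≥ n t (x ∘ Fin.suc)) ⟩
      1F *F (1F -F χsome≥ n t (x ∘ Fin.suc))
        ≡⟨ *-identityˡ _ ⟩
      1F -F χsome≥ n t (x ∘ Fin.suc)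
        ≡⟨ cong (1F -F_) (χ-⇔ (any? (λ i → t ≤? toℕ (x (Fin.suc i)))) (any? (λ i → t ≤? toℕ (x i)))
                              (λ { (i , t≤xᵢ) → Fin.suc i , t≤xᵢ })
                              (λ { (Fin.zero , t≤x₀) → ⊥-elim (t≰x₀ t≤x₀)
                                 ; (Fin.suc i , t≤xᵢ) → i , t≤xᵢ })) ⟩
      1F -F χsome≥ (suc n) t x ∎

  1-[1-c]≡c : ∀ c → 1F -F (1F -F c) ≡ c
  1-[1-c]≡c c = begin
    1F -F (1F -F c)                       ≡⟨ -F≡+negF 1F (1F -F c) ⟩
    1F +F negF (1F -F c)                  ≡⟨ cong (λ u → 1F +F negF u) (-F≡+negF 1F c) ⟩
    1F +F negF (1F +F negF c)             ≡⟨ cong (1F +F_) (-‿+-comm 1F (negF c)) ⟨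
    1F +F (negF 1F +F negF (negF c))      ≡⟨ +-assoc 1F _ _ ⟨
    (1F +F negF 1F) +F negF (negF c)      ≡⟨ cong₂ _+F_ (-‿inverseʳ 1F) (-‿involutive c) ⟩
    0F +F c                               ≡⟨ +-identityˡ c ⟩
    c                                     ∎

  maxF-upperBound : ∀ n (x : Fin n → F) i → toℕ (x i) ≤ toℕ (maxF n x)
  maxF-upperBound (suc n) x i with toℕ (x Fin.zero) ≤ᵇ toℕ (maxF n (x ∘ Fin.suc)) in x₀≤ᵇmax
  maxF-upperBound (suc n) x Fin.zero    | true  = ℕₚ.≤ᵇ⇒≤ _ _ (subst T (sym x₀≤ᵇmax) _)
  maxF-upperBound (suc n) x (Fin.suc i) | true  = maxF-upperBound n (x ∘ Fin.suc) i
  maxF-upperBound (suc n) x Fin.zero    | false = ℕₚ.≤-refl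
  maxF-upperBound (suc n) x (Fin.suc i) | false = ℕₚ.≤-trans (maxF-upperBound n (x ∘ Fin.suc) i)
    (ℕₚ.<⇒≤ (ℕₚ.≰⇒> λ max≤x₀ → subst T x₀≤ᵇmax (ℕₚ.≤⇒≤ᵇ max≤x₀)))

  maxF-attained : ∀ n (x : Fin n → F) → toℕ (maxF n x) ≡ 0 ⊎ ∃ λ i → maxF n x ≡ x i
  maxF-attained zero x = inj₁ toℕ-0F
  maxF-attained (suc n) x with toℕ (x Fin.zero) ≤ᵇ toℕ (maxF n (x ∘ Fin.suc))
  ... | false = inj₂ (Fin.zero , refl)
  ... | true with maxF-attained n (x ∘ Fin.suc)
  ...   | inj₁ max≡0 = inj₁ max≡0
  ...   | inj₂ (i , max≡xᵢ) = inj₂ (Fin.suc i , max≡xᵢ)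

  χsome≥≡χ[t≤maxF] : ∀ n t (x : Fin n → F) → 1 ≤ t → χsome≥ n t x ≡ χ ⌊ t ≤? toℕ (maxF n x) ⌋
  χsome≥≡χ[t≤maxF] n t x 1≤t = χ-⇔ (any? (λ i → t ≤? toℕ (x i))) (t ≤? toℕ (maxF n x))
    (λ (i , t≤xᵢ) → ℕₚ.≤-trans t≤xᵢ (maxF-upperBound n x i))
    (λ t≤max → witness t≤max (maxF-attained n x))
    where
    witness : t ≤ toℕ (maxF n x) → toℕ (maxF n x) ≡ 0 ⊎ ∃ (λ i → maxF n x ≡ x i) →
              ∃ λ i → t ≤ toℕ (x i)
    witness t≤max (inj₁ max≡0) = ⊥-elim (ℕₚ.<⇒≱ 1≤t (ℕₚ.≤-trans t≤max (ℕₚ.≤-reflexive max≡0)))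
    witness t≤max (inj₂ (i , max≡xᵢ)) = i , subst (λ y → t ≤ toℕ y) max≡xᵢ t≤max

  Σχ[1+k≤M]≡⟦m⊓M⟧ : ∀ m M → ΣF m (λ k → χ ⌊ suc k ≤? M ⌋) ≡ ⟦ m ⊓ M ⟧
  Σχ[1+k≤M]≡⟦m⊓M⟧ zero M = refl
  Σχ[1+k≤M]≡⟦m⊓M⟧ (suc m) M with suc m ≤? M
  ... | yes m<M = begin
    ΣF m (λ k → χ ⌊ suc k ≤? M ⌋) +F 1F  ≡⟨ cong (_+F 1F) (Σχ[1+k≤M]≡⟦m⊓M⟧ m M) ⟩
    ⟦ m ⊓ M ⟧ +F ⟦ 1 ⟧                   ≡⟨ ⟦⟧-+ (m ⊓ M) 1 ⟩
    ⟦ m ⊓ M + 1 ⟧                        ≡⟨ cong ⟦_⟧ m⊓M+1≡[1+m]⊓M ⟩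
    ⟦ suc m ⊓ M ⟧                        ∎
    where
    m⊓M+1≡[1+m]⊓M : m ⊓ M + 1 ≡ suc m ⊓ M
    m⊓M+1≡[1+m]⊓M = begin
      m ⊓ M + 1   ≡⟨ cong (_+ 1) (ℕₚ.m≤n⇒m⊓n≡m (ℕₚ.<⇒≤ m<M)) ⟩
      m + 1       ≡⟨ ℕₚ.+-comm m 1 ⟩
      suc m       ≡⟨ ℕₚ.m≤n⇒m⊓n≡m m<M ⟨
      suc m ⊓ M   ∎
  ... | no m≮M = begin
    ΣF m (λ k → χ ⌊ suc k ≤? M ⌋) +F 0F  ≡⟨ +-identityʳ _ ⟩
    ΣF m (λ k → χ ⌊ suc k ≤? M ⌋)        ≡⟨ Σχ[1+k≤M]≡⟦m⊓M⟧ m M ⟩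
    ⟦ m ⊓ M ⟧                            ≡⟨ cong ⟦_⟧ (ℕₚ.m≥n⇒m⊓n≡n (s≤s⁻¹ M<1+m)) ⟩
    ⟦ M ⟧                                ≡⟨ cong ⟦_⟧ (ℕₚ.m≥n⇒m⊓n≡n (ℕₚ.<⇒≤ M<1+m)) ⟨
    ⟦ suc m ⊓ M ⟧                        ∎
    where M<1+m = ℕₚ.≰⇒> m≮M

  maxF≡Σχsome≥ : ∀ n (x : Fin n → F) → maxF n x ≡ ΣF (p ∸ 1) (λ k → χsome≥ n (suc k) x)
  maxF≡Σχsome≥ n x = sym (begin
    ΣF (p ∸ 1) (λ k → χsome≥ n (suc k) x)
      ≡⟨ ΣF-cong (p ∸ 1) (λ k _ → χsome≥≡χ[t≤maxF] n (suc k) x (s≤s z≤n)) ⟩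
    ΣF (p ∸ 1) (λ k → χ ⌊ suc k ≤? M ⌋)    ≡⟨ Σχ[1+k≤M]≡⟦m⊓M⟧ (p ∸ 1) M ⟩
    ⟦ (p ∸ 1) ⊓ M ⟧                        ≡⟨ cong ⟦_⟧ (ℕₚ.m≥n⇒m⊓n≡n M≤p-1) ⟩
    ⟦ M ⟧                                  ≡⟨ ⟦toℕ⟧ (maxF n x) ⟩
    maxF n x                               ∎)
    where
    M = toℕ (maxF n x)
    M≤p-1 : M ≤ p ∸ 1
    M≤p-1 = ℕₚ.m+n≤o⇒m≤o∸n M (ℕₚ.≤-trans (ℕₚ.≤-reflexive (ℕₚ.+-comm M 1)) (Finₚ.toℕ<n (maxF n x)))

module MaxPolynomial (p : ℕ) (p-prime : Prime p) where


  private instance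
    p≢0 : NonZero p
    p≢0 = prime⇒nonZero p-prime

  open Fp p
  open ResidueRing p
  open FiniteSums p
  open Supports p
  open Evaluation p
  open Indicators p
  open Fermat p p-prime using (x^[p∸1]≡1; 1+[p∸1]≡p)
  open ≡-Reasoning

  1≤p∸1 : 1 ≤ p ∸ 1
  1≤p∸1 = ℕₚ.m+n≤o⇒m≤o∸n 1 (PrimeDivisibility.prime⇒1<p p-prime)

  1-[a-k]^[p∸1]≡χ[a≡k] : ∀ a k → k < p → 1F -F ((a -F ⟦ k ⟧) ^F (p ∸ 1)) ≡ χ ⌊ toℕ a ≟ k ⌋
  1-[a-k]^[p∸1]≡χ[a≡k] a k k<p with toℕ a ≟ k
  ... | yes a≡k = begin
    1F -F ((a -F ⟦ k ⟧) ^F (p ∸ 1))   ≡⟨ cong (λ y → 1F -F ((a -F y) ^F (p ∸ 1))) ⟦k⟧≡a ⟩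
    1F -F ((a -F a) ^F (p ∸ 1))       ≡⟨ cong (λ y → 1F -F (y ^F (p ∸ 1))) (trans (-F≡+negF a a) (-‿inverseʳ a)) ⟩
    1F -F (0F ^F (p ∸ 1))             ≡⟨ cong (1F -F_) 0^[p∸1]≡0 ⟩
    1F -F 0F                          ≡⟨ trans (-F≡+negF 1F 0F) (trans (cong (1F +F_) -0#≈0#) (+-identityʳ 1F)) ⟩
    1F                                ∎
    where
    ⟦k⟧≡a : ⟦ k ⟧ ≡ a
    ⟦k⟧≡a = trans (cong ⟦_⟧ (sym a≡k)) (⟦toℕ⟧ a)
    0^[p∸1]≡0 : 0F ^F (p ∸ 1) ≡ 0F
    0^[p∸1]≡0 = subst (λ m → 0F ^F m ≡ 0F) (ℕₚ.m+[n∸m]≡n 1≤p∸1) (zeroˡ _)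
  ... | no a≢k = begin
    1F -F ((a -F ⟦ k ⟧) ^F (p ∸ 1))   ≡⟨ cong (1F -F_) (x^[p∸1]≡1 (a -F ⟦ k ⟧) a-k≢0) ⟩
    1F -F 1F                          ≡⟨ trans (-F≡+negF 1F 1F) (-‿inverseʳ 1F) ⟩
    0F                                ∎
    where
    a-k≢0 : ¬ (a -F ⟦ k ⟧) ≡ 0F
    a-k≢0 a-k≡0 = a≢k (begin
      toℕ a        ≡⟨ cong toℕ (x∙y⁻¹≈ε⇒x≈y a ⟦ k ⟧ (trans (sym (-F≡+negF a ⟦ k ⟧)) a-k≡0)) ⟩
      toℕ ⟦ k ⟧    ≡⟨ toℕ-⟦⟧ k ⟩
      k % p        ≡⟨ m<n⇒m%n≡m k<p ⟩
      k            ∎)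

  L-value : ∀ a t → t ≤ p → ΣF t (λ k → 1F -F ((a -F ⟦ k ⟧) ^F (p ∸ 1))) ≡ χ ⌊ toℕ a <? t ⌋
  L-value a t t≤p = trans (ΣF-cong t λ k k<t → 1-[a-k]^[p∸1]≡χ[a≡k] a k (ℕₚ.<-≤-trans k<t t≤p))
                          (Σχ[a≡k]≡χ[a<t] (toℕ a) t)

  evalBox-L : ∀ n t i x → evalBox n fullBox (L n t i) x ≡ ΣF t (λ k → 1F -F ((x i -F ⟦ k ⟧) ^F (p ∸ 1)))
  evalBox-L n t i x = trans (evalBox-sumP n fullBox t _ x) (ΣF-cong t λ k _ → term k)
    where
    term : ∀ k → evalBox n fullBox (subP n (constP n 1F) (powP n (subP n (varP n i) (constP n ⟦ k ⟧)) (p ∸ 1))) x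
                 ≡ 1F -F ((x i -F ⟦ k ⟧) ^F (p ∸ 1))
    term k = begin
      evalBox n fullBox (subP n (constP n 1F) (powP n X-k (p ∸ 1))) x
        ≡⟨ evalBox-− n fullBox (constP n 1F) (powP n X-k (p ∸ 1)) x ⟩
      evalBox n fullBox (constP n 1F) x -F evalBox n fullBox (powP n X-k (p ∸ 1)) x
        ≡⟨ cong₂ _-F_ (evalBox-const n fullBox 1F x)
                      (evalBox-^ n fullBox (toℕ i) X-k (p ∸ 1) x X-k⊆axis (axisBox-≤ (toℕ i) (p ∸ 1))) ⟩
      1F -F (evalBox n fullBox X-k x ^F (p ∸ 1))
        ≡⟨ cong (λ y → 1F -F (y ^F (p ∸ 1))) (trans (evalBox-− n fullBox (varP n i) (constP n ⟦ k ⟧) x)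
             (cong₂ _-F_ (evalBox-var n fullBox i x 1≤p∸1) (evalBox-const n fullBox ⟦ k ⟧ x))) ⟩
      1F -F ((x i -F ⟦ k ⟧) ^F (p ∸ 1)) ∎
      where
      X-k = subP n (varP n i) (constP n ⟦ k ⟧)
      X-k⊆axis : Supported n (axisBox (toℕ i) 1) X-k
      X-k⊆axis = Supported-− n _ _ _ (Supported-var n i) (Supported-const n _ ⟦ k ⟧)

  evalBox-maxPoly : ∀ n x → evalBox n fullBox (maxPoly n) x ≡ ΣF (p ∸ 1) (λ k → χsome≥ n (suc k) x)
  evalBox-maxPoly n x = trans (evalBox-sumP n fullBox (p ∸ 1) _ x) (ΣF-cong (p ∸ 1) λ k k<p-1 → term k k<p-1)
    where
    term : ∀ k → k < p ∸ 1 →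
           evalBox n fullBox (subP n (constP n 1F) (prodFinP n n (L n (suc k)))) x ≡ χsome≥ n (suc k) x
    term k k<p-1 = begin
      evalBox n fullBox (subP n (constP n 1F) (prodFinP n n (L n (suc k)))) x
        ≡⟨ evalBox-− n fullBox (constP n 1F) (prodFinP n n (L n (suc k))) x ⟩
      evalBox n fullBox (constP n 1F) x -F evalBox n fullBox (prodFinP n n (L n (suc k))) x
        ≡⟨ cong₂ _-F_ (evalBox-const n fullBox 1F x)
                      (evalBox-prodFinP n fullBox n 0 (p ∸ 1) (L n (suc k)) x (Supported-L n (suc k))
                                        (λ _ → ℕₚ.≤-refl)) ⟩
      1F -F ΠF n (λ j → evalBox n fullBox (L n (suc k) j) x)
        ≡⟨ cong (1F -F_) (ΠF-cong n λ j → trans (evalBox-L n (suc k) j x) (L-value (x j) (suc k) 1+k≤p)) ⟩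
      1F -F ΠF n (λ j → χ ⌊ toℕ (x j) <? suc k ⌋)
        ≡⟨ cong (1F -F_) (Πχ[xⱼ<t]≡1-χsome≥ n (suc k) x) ⟩
      1F -F (1F -F χsome≥ n (suc k) x)
        ≡⟨ 1-[1-c]≡c _ ⟩
      χsome≥ n (suc k) x ∎
      where
      1+k≤p : suc k ≤ p
      1+k≤p = ℕₚ.<⇒≤ (ℕₚ.<-≤-trans (s≤s k<p-1) (ℕₚ.≤-reflexive 1+[p∸1]≡p))

  evalReduced-maxPoly : ∀ n x → evalReduced n (maxPoly n) x ≡ maxF n x
  evalReduced-maxPoly n x = begin
    evalReduced n (maxPoly n) x             ≡⟨ evalReduced≡evalBox n (maxPoly n) x ⟩
    evalBox n fullBox (maxPoly n) x         ≡⟨ evalBox-maxPoly n x ⟩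
    ΣF (p ∸ 1) (λ k → χsome≥ n (suc k) x)   ≡⟨ maxF≡Σχsome≥ n x ⟨
    maxF n x                                ∎

proposition3p1 : (p : ℕ) → (pr : Prime p) → (n : ℕ) → 1 ≤ n →
    Fp.IsMinimalPolynomial p {{prime⇒nonZero pr}} n (Fp.maxF p {{prime⇒nonZero pr}} n) (Fp.maxPoly p {{prime⇒nonZero pr}} n)
    × (∀ (x : Fin n → Fp.F p {{prime⇒nonZero pr}}) → Fp.maxF p {{prime⇒nonZero pr}} n x
        ≡ Fp.ΣF p {{prime⇒nonZero pr}} (p ∸ 1) (λ k → Fp.χsome≥ p {{prime⇒nonZero pr}} n (suc k) x))
proposition3p1 p pr n _ =
    (maxPoly-reduced n , evalReduced-maxPoly n)
  , maxF≡Σχsome≥ n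
  where
  instance
    p≢0 : NonZero p
    p≢0 = prime⇒nonZero pr
  open Supports p using (maxPoly-reduced)
  open Indicators p using (maxF≡Σχsome≥)
  open MaxPolynomial p pr using (evalReduced-maxPoly)
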